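{- No tree with at least two vertices admits an IRC-coloring.
   Context: Private neighbors. For $S\subseteq V(G)$ and $v\in S$, $pn[v,S]=N[v]\setminus\bigcup_{u\in S\setminus\{v\}}N[u]$, where $N[\cdot]$ is the closed neighborhood. $S$ is irredundant if $pn[v,S]\ne\emptyset$ for all $v\in S$. Rainbow committees and IRC-colorings. For a proper coloring of $G$ with nonempty color classes $V_1,\dots,V_k$, a rainbow committee is a set containing exactly one vertex of each color class. An irredundance compelling coloring (IRC-coloring) is a proper coloring in which every rainbow committee is an irredundant set. -}

module Defs where

open import Level using (0ℓ)
open import Data.Nat using (ℕ; _≤_)
open import Data.Fin using (Fin)
open import Data.Fin.Subset using (Subset; _∈_; _∉_)
open import Data.List using (List; []; _∷_; length; _∷ʳ_)
open import Data.List.Relation.Unary.Unique.Propositional using (Unique)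
open import Data.List.Relation.Unary.Linked using (Linked)
open import Data.Product using (Σ; ∃; _×_; _,_)
open import Data.Sum using (_⊎_)
open import Relation.Nullary using (¬_; Dec)
open import Relation.Binary.PropositionalEquality using (_≡_; _≢_)

record Graph (n : ℕ) : Set₁ where
  field
    Adj   : Fin n → Fin n → Set
    adj?  : ∀ u v → Dec (Adj u v)
    sym   : ∀ {u v} → Adj u v → Adj v u
    irrefl : ∀ {u} → ¬ Adj u u

module _ {n : ℕ} (G : Graph n) where
  open Graph G

  data Walk : Fin n → Fin n → Set where
    here : ∀ {v} → Walk v v
    step : ∀ {u w v} → Adj u w → Walk w v → Walk u v

  Connected : Set
  Connected = ∀ u v → Walk u v

  HasCycle : Set
  HasCycle = Σ (Fin n) λ x → Σ (List (Fin n)) λ vs →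
    (2 ≤ length vs) × Unique (x ∷ vs) × Linked Adj ((x ∷ vs) ∷ʳ x)

  Acyclic : Set
  Acyclic = ¬ HasCycle

  IsTree : Set
  IsTree = Connected × Acyclic

  InN : Fin n → Fin n → Set
  InN v u = u ≡ v ⊎ Adj v u

  PrivNeighbor : Subset n → Fin n → Fin n → Set
  PrivNeighbor S v w = InN v w × (∀ u → u ∈ S → u ≢ v → ¬ InN u w)

  Irredundant : Subset n → Set
  Irredundant S = ∀ v → v ∈ S → ∃ λ w → PrivNeighbor S v w

  Proper : {k : ℕ} → (Fin n → Fin k) → Set
  Proper c = ∀ u v → Adj u v → c u ≢ c v

  AllClassesNonempty : {k : ℕ} → (Fin n → Fin k) → Set
  AllClassesNonempty {k} c = ∀ (i : Fin k) → ∃ λ v → c v ≡ i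

  -- S contains exactly one vertex of each colour class
  -- (every vertex lies in some class, so S contains nothing else)
  RainbowCommittee : {k : ℕ} → (Fin n → Fin k) → Subset n → Set
  RainbowCommittee {k} c S = ∀ (i : Fin k) → ∃ λ v →
    (v ∈ S × c v ≡ i) × (∀ u → u ∈ S → c u ≡ i → u ≡ v)

  IRCColoring : {k : ℕ} → (Fin n → Fin k) → Set
  IRCColoring c = Proper c × AllClassesNonempty c ×
    (∀ S → RainbowCommittee c S → Irredundant S)

-- A tree with at least two vertices has a pendant vertex x, whose only neighbour y
-- satisfies N[x] ⊆ N[y]. Since x and y are adjacent they get different colours, so
-- some rainbow committee contains both; in it every vertex of N[x] is also dominated
-- by y, so x has no private neighbour and the committee is not irredundant.
module Submission where

open import Defs
open import Level using (Level)
open import Data.Nat using (ℕ; zero; suc; _+_; _<_; _≤_; _≤?_; s≤s; z≤n)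
open import Data.Nat.Properties using (≰⇒>; <⇒≱; n<1+n; m<n⇒m<1+n; +-suc; +-identityʳ)
open import Data.Fin using (Fin) renaming (zero to fzero; suc to fsuc)
open import Data.Fin.Properties using (_≟_; any?; pigeonhole; <⇒≢)
open import Data.Fin.Subset using (Subset; _∈_)
open import Data.Vec using (tabulate)
open import Data.Vec.Properties using (lookup∘tabulate; lookup⇒[]=; []=⇒lookup)
open import Data.Bool.Properties using (T-≡)
open import Data.List using (List; []; _∷_; length; _∷ʳ_; lookup)
open import Data.List.Properties using (length-++-≤ʳ)
open import Data.List.Membership.Propositional using () renaming (_∈_ to _∈ˡ_)
open import Data.List.Membership.Propositional.Properties using (∈-lookup)
open import Data.List.Relation.Unary.All as All using (All; []; _∷_)
open import Data.List.Relation.Unary.All.Properties using (¬Any⇒All¬)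
open import Data.List.Relation.Unary.Any using (here; there)
open import Data.List.Relation.Unary.AllPairs using ([]; _∷_)
open import Data.List.Relation.Unary.Unique.Propositional using (Unique)
open import Data.List.Relation.Unary.Linked using (Linked; []; [-]; _∷_)
open import Data.Product using (∃; ∃₂; _×_; _,_; proj₁; proj₂)
open import Data.Sum using (_⊎_; inj₁; inj₂)
open import Function.Bundles using (Equivalence)
open import Relation.Nullary using (¬_; yes; no; contradiction)
open import Relation.Nullary.Decidable using (isYes; toWitness; fromWitness; _×-dec_; ¬?)
open import Relation.Unary using (Pred; Decidable)
open import Relation.Binary.PropositionalEquality using (_≡_; _≢_; refl; sym; trans; cong; subst)

module _ {A : Set} where

  lookup-injective : ∀ {xs : List A} → Unique xs → ∀ i j → lookup xs i ≡ lookup xs j → i ≡ j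
  lookup-injective (x∉ ∷ u) fzero    fzero    eq = refl
  lookup-injective (x∉ ∷ u) fzero    (fsuc j) eq = contradiction eq (All.lookup x∉ (∈-lookup j))
  lookup-injective (x∉ ∷ u) (fsuc i) fzero    eq = contradiction (sym eq) (All.lookup x∉ (∈-lookup i))
  lookup-injective (x∉ ∷ u) (fsuc i) (fsuc j) eq = cong fsuc (lookup-injective u i j eq)

  Linked-∷ʳ : ∀ {R : A → A → Set} xs {a b} → Linked R (xs ∷ʳ a) → R a b → Linked R ((xs ∷ʳ a) ∷ʳ b)
  Linked-∷ʳ []           [-]       Rab = Rab ∷ [-]
  Linked-∷ʳ (x ∷ [])     (Rxa ∷ l) Rab = Rxa ∷ Linked-∷ʳ [] l Rab
  Linked-∷ʳ (x ∷ y ∷ xs) (Rxy ∷ l) Rab = Rxy ∷ Linked-∷ʳ (y ∷ xs) l Rab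

  prefixUpTo : ∀ {R : A → A → Set} {z ys w} → w ∈ˡ ys → Linked R (z ∷ ys) → Unique (z ∷ ys) →
    ∃ λ s → Linked R ((z ∷ s) ∷ʳ w) × Unique ((z ∷ s) ∷ʳ w) × All (_∈ˡ ys) (s ∷ʳ w)
  prefixUpTo (here refl) (Rzw ∷ _) ((z≢w ∷ _) ∷ _) =
    [] , Rzw ∷ [-] , (z≢w ∷ []) ∷ [] ∷ [] , here refl ∷ []
  prefixUpTo {ys = y ∷ _} (there w∈) (Rzy ∷ l) (z∉ ∷ u) =
    let s , l′ , u′ , s⊆ = prefixUpTo w∈ l u
    in y ∷ s , Rzy ∷ l′ ,
       (All.head z∉ ∷ All.map (All.lookup (All.tail z∉)) s⊆) ∷ u′ ,
       here refl ∷ All.map there s⊆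

unique⇒length≤ : ∀ {n} {xs : List (Fin n)} → Unique xs → length xs ≤ n
unique⇒length≤ {n} {xs} u with length xs ≤? n
... | yes len≤n = len≤n
... | no len≰n with pigeonhole (≰⇒> len≰n) (lookup xs)
...   | i , j , i<j , eq = contradiction (lookup-injective u i j eq) (<⇒≢ i<j)

module _ {n : ℕ} where

  subsetOf : {ℓ : Level} {P : Pred (Fin n) ℓ} → Decidable P → Subset n
  subsetOf P? = tabulate (λ v → isYes (P? v))

  ∈-subsetOf⁺ : {ℓ : Level} {P : Pred (Fin n) ℓ} (P? : Decidable P) → ∀ {v} → P v → v ∈ subsetOf P?
  ∈-subsetOf⁺ P? {v} Pv =
    lookup⇒[]= v (subsetOf P?) (trans (lookup∘tabulate _ v) (Equivalence.to T-≡ (fromWitness Pv)))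

  ∈-subsetOf⁻ : {ℓ : Level} {P : Pred (Fin n) ℓ} (P? : Decidable P) → ∀ {v} → v ∈ subsetOf P? → P v
  ∈-subsetOf⁻ P? {v} v∈ =
    toWitness (Equivalence.from T-≡ (trans (sym (lookup∘tabulate _ v)) ([]=⇒lookup v∈)))

module _ {n : ℕ} (G : Graph n) where
  open Graph G renaming (sym to Adj-sym)
  open import Data.List.Membership.DecPropositional (_≟_ {n}) using () renaming (_∈?_ to _∈ˡ?_)

  IsPath : List (Fin n) → Set
  IsPath xs = Linked Adj xs × Unique xs

  Pendant : Fin n → Fin n → Set
  Pendant x y = Adj x y × (∀ z → Adj x z → z ≡ y)

  Adj⇒≢ : ∀ {u v} → Adj u v → u ≢ v
  Adj⇒≢ {u} a refl = irrefl a

  closing-edge⇒cycle : ∀ {v u rest w} → IsPath (v ∷ u ∷ rest) → w ∈ˡ rest → Adj v w → HasCycle G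
  closing-edge⇒cycle {v} {w = w} (l@(_ ∷ l₀) , u!@(_ ∷ u!₀)) w∈ avw =
    let s , l′ , u′ , _ = prefixUpTo (there w∈) l u!
    in v , s ∷ʳ w , s≤s (length-++-≤ʳ (w ∷ []) {proj₁ (prefixUpTo w∈ l₀ u!₀)}) ,
       u′ , Linked-∷ʳ (v ∷ s) l′ (Adj-sym avw)

  -- A neighbour w ≠ u of v cannot lie on the path: the edge vw would close a cycle.
  pendant-or-extend : Acyclic G → ∀ {v u rest} → IsPath (v ∷ u ∷ rest) →
    Pendant v u ⊎ ∃ λ w → IsPath (w ∷ v ∷ u ∷ rest)
  pendant-or-extend acyclic {v} {u} {rest} p@(avu ∷ _ , v!) with any? (λ w → adj? v w ×-dec ¬? (w ≟ u))
  ... | no ∄w = inj₁ (avu , only-u)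
    where
    only-u : ∀ z → Adj v z → z ≡ u
    only-u z avz with z ≟ u
    ... | yes z≡u = z≡u
    ... | no  z≢u = contradiction (z , avz , z≢u) ∄w
  ... | yes (w , avw , w≢u) with w ∈ˡ? rest
  ...   | yes w∈ = contradiction (closing-edge⇒cycle p w∈ avw) acyclic
  ...   | no  w∉ = inj₂ (w , Adj-sym avw ∷ proj₁ p ,
                         (Adj⇒≢ (Adj-sym avw) ∷ w≢u ∷ ¬Any⇒All¬ rest w∉) ∷ v!)

  acyclic⇒pendant : Acyclic G → ∀ {u v} → Adj u v → ∃₂ Pendant
  acyclic⇒pendant acyclic {u} {v} auv = grow n edge (m<n⇒m<1+n (n<1+n n))
    where
    edge : IsPath (v ∷ u ∷ [])
    edge = Adj-sym auv ∷ [-] , (Adj⇒≢ (Adj-sym auv) ∷ []) ∷ [] ∷ []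
    grow : ∀ fuel {v u rest} → IsPath (v ∷ u ∷ rest) → n < length (v ∷ u ∷ rest) + fuel → ∃₂ Pendant
    grow zero p bound =
      contradiction (unique⇒length≤ (proj₂ p)) (<⇒≱ (subst (n <_) (+-identityʳ _) bound))
    grow (suc fuel) {v} {u} {rest} p bound with pendant-or-extend acyclic p
    ... | inj₁ pendant = _ , _ , pendant
    ... | inj₂ (_ , p′) = grow fuel p′ (subst (n <_) (+-suc (length (v ∷ u ∷ rest)) fuel) bound)

  pendant⇒N[]⊆ : ∀ {x y} → Pendant x y → ∀ {w} → InN G x w → InN G y w
  pendant⇒N[]⊆ (axy , _)    (inj₁ refl) = inj₂ (Adj-sym axy)
  pendant⇒N[]⊆ (_ , only-y) (inj₂ axw)  = inj₁ (only-y _ axw)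

  dominated⇒¬private : ∀ {S u v w} → u ∈ S → u ≢ v → (∀ {w} → InN G v w → InN G u w) →
    ¬ PrivNeighbor G S v w
  dominated⇒¬private u∈S u≢v N[v]⊆N[u] (w∈N[v] , undominated) =
    undominated _ u∈S u≢v (N[v]⊆N[u] w∈N[v])

  module _ {k : ℕ} (c : Fin n → Fin k) where

    IsSection : (Fin k → Fin n) → Set
    IsSection r = ∀ i → c (r i) ≡ i

    redirect : (Fin k → Fin n) → Fin n → Fin k → Fin n
    redirect r x i with i ≟ c x
    ... | yes _ = x
    ... | no  _ = r i

    redirect-section : ∀ {r} x → IsSection r → IsSection (redirect r x)
    redirect-section x sec i with i ≟ c x
    ... | yes i≡cx = sym i≡cx
    ... | no  _    = sec i

    redirect-hit : ∀ r x → redirect r x (c x) ≡ x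
    redirect-hit r x with c x ≟ c x
    ... | yes _   = refl
    ... | no  c≢c = contradiction refl c≢c

    redirect-miss : ∀ r x {i} → i ≢ c x → redirect r x i ≡ r i
    redirect-miss r x {i} i≢cx with i ≟ c x
    ... | yes i≡cx = contradiction i≡cx i≢cx
    ... | no  _    = refl

    committee : (Fin k → Fin n) → Subset n
    committee r = subsetOf (λ v → v ≟ r (c v))

    section⇒rainbowCommittee : ∀ {r} → IsSection r → RainbowCommittee G c (committee r)
    section⇒rainbowCommittee {r} sec i =
      r i , (∈-subsetOf⁺ _ (cong r (sym (sec i))) , sec i) ,
      λ u u∈ cu≡i → trans (∈-subsetOf⁻ _ u∈) (cong r cu≡i)

  pendant⇒¬IRCColoring : ∀ {x y} → Pendant x y → ∀ {k} (c : Fin n → Fin k) → ¬ IRCColoring G c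
  pendant⇒¬IRCColoring {x} {y} pendant@(axy , _) {k} c (proper , nonempty , irc) =
    dominated⇒¬private y∈S (Adj⇒≢ (Adj-sym axy)) (pendant⇒N[]⊆ pendant) (proj₂ privateOfX)
    where
    r : Fin k → Fin n
    r = redirect c (redirect c (λ i → proj₁ (nonempty i)) x) y
    sec : IsSection c r
    sec = redirect-section c y (redirect-section c x (λ i → proj₂ (nonempty i)))
    rx≡x : r (c x) ≡ x
    rx≡x = trans (redirect-miss c _ y (proper x y axy)) (redirect-hit c _ x)
    ∈committee : ∀ {v} → r (c v) ≡ v → v ∈ committee c r
    ∈committee rv≡v = ∈-subsetOf⁺ _ (sym rv≡v)
    y∈S : y ∈ committee c r
    y∈S = ∈committee (redirect-hit c _ y)
    privateOfX : ∃ λ w → PrivNeighbor G (committee c r) x w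
    privateOfX = irc (committee c r) (section⇒rainbowCommittee c sec) x (∈committee rx≡x)

  connected⇒edge : 2 ≤ n → Connected G → ∃₂ Adj
  connected⇒edge (s≤s (s≤s _)) connected with connected fzero (fsuc fzero)
  ... | step a _ = _ , _ , a

corollary3 : (n : ℕ) → 2 ≤ n → (G : Graph n) → IsTree G →
    (k : ℕ) → (c : Fin n → Fin k) → ¬ IRCColoring G c
corollary3 n 2≤n G (connected , acyclic) k c
  with _ , _ , edge ← connected⇒edge G 2≤n connected
  with _ , _ , pendant ← acyclic⇒pendant G acyclic edge
  = pendant⇒¬IRCColoring G pendant c
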